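{- Let $S$ be a set of $m\ge2$ finite strings, no one a substring of another, and let $S'$ be obtained from $S$ by the small-cycle modification. Then the length of a shortest superstring of $S'$ is at most the length of a shortest superstring of $S$ plus $\sum_{c\in\mathcal{S}(S)}w(c)$.
   Context: For strings $s\neq t$, $\mathrm{ov}(s,t)$ is the longest suffix of $s$ that is a prefix of $t$; $\mathrm{ov}(s,s)$ is the longest suffix of $s$ of length less than $|s|$ that is also a prefix of $s$; $s=\mathrm{pref}(s,t)\mathrm{ov}(s,t)$, $\mathrm{dist}(s,t)=|\mathrm{pref}(s,t)|$. $\mathcal{C}(S)$ is the cycle cover computed by MGREEDY (fixed tie-breaking): sort all ordered pairs $(s,t)$ of $S$ (including $s=t$) by non-increasing $|\mathrm{ov}(s,t)|$, scan and add $(s,t)$ iff no previously added edge has tail $s$ or head $t$. Write each cycle as $c=s_{c_0}\to\dots\to s_{c_{r-1}}\to s_{c_0}$ where $(s_{c_{r-1}},s_{c_0})$ is its cycle-closing edge (the last edge of $c$ added by MGREEDY); $w(c)$ is the sum of $\mathrm{dist}$ over its edges and $o(c)=|\mathrm{ov}(s_{c_{r-1}},s_{c_0})|$. A cycle is small if $o(c)>2w(c)$; $\mathcal{S}(S)$ is the set of small cycles of $\mathcal{C}(S)$. Small-cycle modification: for each small cycle $c$, remove all strings of $c$ from $S$ and add the string $R'_c=\mathrm{pref}(s_{c_0},s_{c_1})\cdots\mathrm{pref}(s_{c_{r-2}},s_{c_{r-1}})\mathrm{pref}(s_{c_{r-1}},s_{c_0})\,s_{c_0}$; the resulting set is $S'$.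 -}

module Defs where

open import Data.Nat using (ℕ; zero; suc; _+_; _*_; _∸_; _<_; _≤_; _<ᵇ_)
open import Data.Bool using (Bool; true; false; if_then_else_; not; _∧_; _∨_)
open import Data.Fin using (Fin)
import Data.Fin as Fin
open import Data.List using (List; []; _∷_; [_]; _++_; length; take; drop; map; concat; filter; foldl; foldr; allFin; cartesianProduct)
open import Data.Bool.ListAction using (any)
open import Data.Nat.ListAction using (sum)
open import Data.Bool using (T)
open import Data.Bool.Properties using (T?)
import Data.List.Properties as LP
open import Data.List.Membership.Propositional using (_∈_)
open import Data.Product using (_×_; _,_; proj₁; proj₂; ∃; ∃-syntax)
open import Relation.Binary.PropositionalEquality using (_≡_)
open import Relation.Binary.Definitions using (DecidableEquality)
open import Relation.Nullary.Decidable using (⌊_⌋; yes; no)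

_=ᶠ_ : ∀ {m} → Fin m → Fin m → Bool
i =ᶠ j = ⌊ i Fin.≟ j ⌋

module _ {A : Set} (_≟_ : DecidableEquality A) where

  String : Set
  String = List A

  _==_ : String → String → Bool
  s == t = ⌊ LP.≡-dec _≟_ s t ⌋

  Substring : String → String → Set
  Substring u t = ∃[ xs ] ∃[ ys ] (xs ++ u ++ ys ≡ t)

  IsSuperstring : List String → String → Set
  IsSuperstring L t = ∀ u → u ∈ L → Substring u t

  IsShortestSuperstring : List String → String → Set
  IsShortestSuperstring L t =
    IsSuperstring L t × (∀ u → IsSuperstring L u → length t ≤ length u)

  -- Overlaps.  ovLen s t = |ov(s,t)|: the largest k such that the length-k
  -- suffix of s equals the length-k prefix of t, where k ≤ |s|, and
  -- k < |s| when s = t (for s = t a proper suffix is required).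

  suffixIsPrefix : String → String → ℕ → Bool
  suffixIsPrefix s t k = (drop (length s ∸ k) s) == (take k t)

  searchOv : String → String → ℕ → ℕ
  searchOv s t zero = zero
  searchOv s t (suc k) =
    if suffixIsPrefix s t (suc k) then suc k else searchOv s t k

  ovLen : String → String → ℕ
  ovLen s t = searchOv s t (if s == t then length s ∸ 1 else length s)

  -- s = pref(s,t) ov(s,t)
  pref : String → String → String
  pref s t = take (length s ∸ ovLen s t) s

  dist : String → String → ℕ
  dist s t = length (pref s t)

  -- MGREEDY on an indexed set  S : Fin m → String.
  -- An edge (i , j) stands for the ordered pair (S i , S j).

  module MGreedy {m : ℕ} (S : Fin m → String) where

    Edge : Set
    Edge = Fin m × Fin m

    allPairs : List Edge
    allPairs = cartesianProduct (allFin m) (allFin m)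

    ovE : Edge → ℕ
    ovE (i , j) = ovLen (S i) (S j)

    -- one scan step: add (i , j) iff no previously added edge has tail i
    -- or head j.  Edges are kept in the order in which they were added.
    greedyStep : List Edge → Edge → List Edge
    greedyStep acc (i , j) =
      if any (λ e → (proj₁ e =ᶠ i) ∨ (proj₂ e =ᶠ j)) acc
      then acc else acc ++ [ (i , j) ]

    mgreedy : List Edge → List Edge
    mgreedy order = foldl greedyStep [] order

    module Cover (order : List Edge) where

      edges : List Edge
      edges = mgreedy order

      succ : Fin m → Fin m
      succ i = foldr (λ e r → if proj₁ e =ᶠ i then proj₂ e else r) i edges

      orbitFrom : ℕ → Fin m → Fin m → List (Fin m)
      orbitFrom zero    start v = []
      orbitFrom (suc n) start v =
        v ∷ (if succ v =ᶠ start then [] else orbitFrom n start (succ v))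

      orbit : Fin m → List (Fin m)
      orbit v = orbitFrom m v v

      inList : Fin m → List (Fin m) → Bool
      inList i vs = any (i =ᶠ_) vs

      -- head of the cycle-closing edge (last added edge) of the cycle of v
      closingHead : Fin m → Fin m
      closingHead v =
        foldl (λ r e → if inList (proj₁ e) (orbit v) then proj₂ e else r) v edges

      -- each cycle c is represented by c₀ = head of its closing edge;
      -- orbit c₀ = c₀ , c₁ , … , c_{r-1}, and (c_{r-1} , c₀) is closing.
      cycleStarts : List (Fin m)
      cycleStarts = filter (λ v → closingHead v Fin.≟ v) (allFin m)

      w : Fin m → ℕ
      w c₀ = sum (map (λ i → dist (S i) (S (succ i))) (orbit c₀))

      lastOf : Fin m → List (Fin m) → Fin m
      lastOf d []       = d
      lastOf d (x ∷ xs) = lastOf x xs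

      o : Fin m → ℕ
      o c₀ = ovLen (S (lastOf c₀ (orbit c₀))) (S c₀)

      isSmall : Fin m → Bool
      isSmall c₀ = (2 * w c₀) <ᵇ o c₀

      smallCycles : List (Fin m)
      smallCycles = filter (λ c₀ → T? (isSmall c₀)) cycleStarts

      R′ : Fin m → String
      R′ c₀ = concat (map (λ i → pref (S i) (S (succ i))) (orbit c₀)) ++ S c₀

      inSmallCycle : Fin m → Bool
      inSmallCycle i = any (λ c₀ → inList i (orbit c₀)) smallCycles

      S′ : List String
      S′ = map S (filter (λ i → T? (not (inSmallCycle i))) (allFin m))
           ++ map R′ smallCycles

      smallWeight : ℕ
      smallWeight = sum (map w smallCycles)

{-# OPTIONS --safe #-}
-- Let t be a shortest superstring of S and c a small cycle with representative c₀. Since the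
-- closing edge of c returns to c₀, the word P = pref(c₀,c₁)⋯pref(c_{r-1},c₀) satisfies
-- P s_{c₀} = s_{c₀} Q for some Q. Inserting P just before an occurrence of s_{c₀} in t
-- therefore creates the factor R'_c = P s_{c₀} at cost |P| = w(c); and since the new text also
-- reads as t with Q inserted just after that occurrence, every factor of t survives unless it
-- properly contains s_{c₀}, which no string of S does. Performing the insertions from the
-- rightmost occurrence leftwards keeps the remaining occurrences in place and the factors R'
-- already created intact.
module Submission where

open import Defs
open import Data.Nat using (ℕ; zero; suc; _+_; _∸_; _≤_; s≤s; NonZero)
open import Data.Nat.Properties using (≤-refl; ≤-trans; ≤-reflexive; ≤-total; ≤-decTotalOrder; +-assoc; +-comm; +-identityʳ; m≤m+n)
open import Data.Nat.ListAction using (sum)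
open import Data.Nat.ListAction.Properties using (sum-↭)
open import Data.List using (List; []; _∷_; _++_; length; map; concat; take; drop; foldl; foldr; filter; allFin)
import Data.List.Properties as LP
open import Data.List.Properties using (take++drop≡id; drop-all; map-∘; map-cong; ++-assoc; ++-identityʳ; ∷-injective; length-++; length-++-comm; length-++-≤ˡ; ++-monoid)
open import Data.List.Membership.Propositional using (_∈_)
open import Data.List.Membership.Propositional.Properties using (∈-map⁺; ∈-map⁻; ∈-allFin; ∈-filter⁻; ∈-++⁻)
open import Data.List.Relation.Unary.All using (All; []; _∷_)
import Data.List.Relation.Unary.All as All
import Data.List.Relation.Unary.All.Properties as All
open import Data.List.Relation.Unary.AllPairs using (AllPairs; []; _∷_)
import Data.List.Relation.Unary.AllPairs.Properties as AllPairs
open import Data.List.Relation.Unary.Any using (here; there)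
import Data.List.Relation.Unary.Any as Any
open import Data.List.Relation.Unary.Any.Properties using (any⁺; any⁻)
open import Data.List.Relation.Unary.Linked using (Linked; [-]; _∷_)
open import Data.List.Relation.Unary.Linked.Properties using (Linked⇒AllPairs)
open import Data.List.Relation.Binary.Permutation.Propositional using (_↭_; ↭-sym)
open import Data.List.Relation.Binary.Permutation.Propositional.Properties using (All-resp-↭)
import Data.List.Relation.Binary.Permutation.Propositional.Properties as Perm
import Data.List.Sort as Sort
import Relation.Binary.Construct.On as On
import Relation.Binary.Construct.Flip.EqAndOrd as Flip
open import Data.Product using (_×_; _,_; proj₁; proj₂; ∃-syntax; map₁; map₂)
open import Data.Sum using (_⊎_; inj₁; inj₂) renaming (map to ⊎-map)
open import Data.Bool using (Bool; true; false; T; if_then_else_; _∨_; not)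
open import Data.Bool.Properties using (T-∨; T?)
open import Data.Bool.ListAction using (any)
open import Data.Fin using (Fin)
import Data.Fin as Fin
open import Data.Fin.Properties using (nonZeroIndex)
open import Function using (_∘_; _$_)
open import Function.Definitions using (Injective)
open import Function.Bundles using (Equivalence)
open import Relation.Binary.Definitions using (DecidableEquality)
open import Relation.Nullary using (¬_; yes; no; contradiction)
open import Relation.Nullary.Decidable using (toWitness; fromWitness)
open import Relation.Binary.PropositionalEquality using (_≡_; _≢_; refl; sym; trans; cong; subst; module ≡-Reasoning)
open import Tactic.MonoidSolver using (solve)

module _ {A : Set} where

  OccursAt : List A → List A → List A → Set
  OccursAt a u t = ∃[ b ] (a ++ u ++ b ≡ t)

  Factor : List A → List A → Set
  Factor u t = ∃[ a ] OccursAt a u t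

  levi : ∀ (a b c d : List A) → a ++ b ≡ c ++ d →
         (∃[ e ] (c ≡ a ++ e × b ≡ e ++ d)) ⊎ (∃[ e ] (a ≡ c ++ e × d ≡ e ++ b))
  levi []      b c       d eq = inj₁ (c , refl , eq)
  levi (x ∷ a) b []      d eq = inj₂ (x ∷ a , refl , sym eq)
  levi (x ∷ a) b (y ∷ c) d eq with ∷-injective eq
  ... | refl , eq′ = ⊎-map (map₂ (map₁ (cong (x ∷_)))) (map₂ (map₁ (cong (x ∷_)))) (levi a b c d eq′)

  length-++-≤⇒≡[] : ∀ (a e : List A) → length (a ++ e) ≤ length a → e ≡ []
  length-++-≤⇒≡[] []      []      _         = refl
  length-++-≤⇒≡[] (_ ∷ a) e       (s≤s le) = length-++-≤⇒≡[] a e le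

  levi-≤ : ∀ (a b c d : List A) → a ++ b ≡ c ++ d → length c ≤ length a →
           ∃[ e ] (a ≡ c ++ e × d ≡ e ++ b)
  levi-≤ a b c d eq c≤a with levi a b c d eq
  ... | inj₂ split = split
  ... | inj₁ (e , refl , refl) with length-++-≤⇒≡[] a e c≤a
  ...   | refl = [] , sym (trans (++-identityʳ _) (++-identityʳ a)) , refl

  ++-identityˡ-unique-infix : ∀ (e s g : List A) → s ≡ e ++ s ++ g → e ≡ []
  ++-identityˡ-unique-infix e s g eq = length-++-≤⇒≡[] (s ++ g) e (begin
    length ((s ++ g) ++ e)  ≡⟨ length-++-comm (s ++ g) e ⟩
    length (e ++ s ++ g)    ≡⟨ cong length eq ⟨
    length s                ≤⟨ length-++-≤ˡ s ⟩
    length (s ++ g)         ∎)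
    where open Data.Nat.Properties.≤-Reasoning

  length-insert : ∀ (x P e : List A) → length (x ++ P ++ e) ≡ length (x ++ e) + length P
  length-insert []      P e = trans (length-++ P) (+-comm (length P) (length e))
  length-insert (_ ∷ x) P e = cong suc (length-insert x P e)

  ends-within : ∀ {a u b x s y} → a ++ u ++ b ≡ x ++ s ++ y → length a ≤ length x →
                (Factor s u → u ≡ s) → ∃[ r ] (a ++ u ++ r ≡ x ++ s)
  ends-within {a} {u} {b} {x} {s} {y} eq a≤x maximal
    with levi-≤ x (s ++ y) a (u ++ b) (sym eq) a≤x
  ... | e , refl , ub with levi u b (e ++ s) y (trans ub (sym (++-assoc e s y)))
  ...   | inj₁ (r , es≡ur , _) = r , trans (cong (a ++_) (sym es≡ur)) (sym (++-assoc a e s))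
  ...   | inj₂ (g , u≡esg , _) with maximal (e , g , sym (trans u≡esg (++-assoc e s g)))
  ...     | refl with ++-identityˡ-unique-infix e u g (trans u≡esg (++-assoc e u g))
  ...       | refl = [] , solve (++-monoid A)

  late-survives : ∀ {u x s y} a P → OccursAt a u (x ++ s ++ y) → length x ≤ length a →
                  ∃[ a′ ] (length a ≤ length a′ × OccursAt a′ u (x ++ P ++ s ++ y))
  late-survives {u} {x} {s} {y} a P (b , eq) x≤a with levi-≤ a (u ++ b) x _ eq x≤a
  ... | e , refl , sy =
    x ++ P ++ e ,
    ≤-trans (m≤m+n _ (length P)) (≤-reflexive (sym (length-insert x P e))) ,
    b , (begin
      (x ++ P ++ e) ++ u ++ b   ≡⟨ solve (++-monoid A) ⟩
      x ++ P ++ e ++ u ++ b     ≡⟨ cong (λ z → x ++ P ++ z) sy ⟨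
      x ++ P ++ s ++ y          ∎)
    where open ≡-Reasoning

  module _ {P s Q : List A} (conj : P ++ s ≡ s ++ Q) (x y : List A) where

    -- The new text also reads x ++ s ++ Q ++ y, so a factor ending inside x ++ s stays in place.
    early-survives : ∀ a {u} → OccursAt a u (x ++ s ++ y) → length a ≤ length x →
                     (Factor s u → u ≡ s) → OccursAt a u (x ++ P ++ s ++ y)
    early-survives a {u} (b , eq) a≤x maximal with ends-within {a} {u} {b} {x} {s} {y} eq a≤x maximal
    ... | r , eq′ = r ++ Q ++ y , (begin
      a ++ u ++ r ++ Q ++ y     ≡⟨ solve (++-monoid A) ⟩
      (a ++ u ++ r) ++ Q ++ y   ≡⟨ cong (_++ Q ++ y) eq′ ⟩
      (x ++ s) ++ Q ++ y        ≡⟨ solve (++-monoid A) ⟩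
      x ++ (s ++ Q) ++ y        ≡⟨ cong (λ z → x ++ z ++ y) conj ⟨
      x ++ (P ++ s) ++ y        ≡⟨ solve (++-monoid A) ⟩
      x ++ P ++ s ++ y          ∎)
      where open ≡-Reasoning

    factor-survives : ∀ {u} → (Factor s u → u ≡ s) → Factor u (x ++ s ++ y) → Factor u (x ++ P ++ s ++ y)
    factor-survives maximal (a , occ) with ≤-total (length a) (length x)
    ... | inj₁ a≤x = a , early-survives a occ a≤x maximal
    ... | inj₂ x≤a = map₂ proj₂ (late-survives {x = x} {s} {y} a P occ x≤a)

  -- Put block right in front of the occurrence of word that follows the prefix pos of the text.
  record Insertion : Set where
    field
      pos word block : List A

  open Insertion

  module Insertions (Keep : List A → Set) where

    record Admissible (k : Insertion) : Set where
      field
        conjugate : ∃[ Q ] (block k ++ word k ≡ word k ++ Q)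
        kept      : Keep (word k)
        maximal   : ∀ {u} → Keep u → Factor (word k) u → u ≡ word k

    record Inserted (T : List Insertion) (t t′ : List A) : Set where
      field
        length-t′ : length t′ ≡ length t + sum (map (length ∘ block) T)
        keeps     : ∀ {u} → Keep u → Factor u t′
        blocks    : All (λ k → Factor (block k ++ word k) t′) T

    RightOf : List Insertion → List A → Set
    RightOf T a = All (λ k → length (pos k) ≤ length a) T

    RightFactorsSurvive : List Insertion → List A → List A → Set
    RightFactorsSurvive T t t′ = ∀ a {u} → RightOf T a → OccursAt a u t → Factor u t′

    insert-sorted : ∀ T {t} → AllPairs (λ k j → length (pos j) ≤ length (pos k)) T →
      All Admissible T → All (λ k → OccursAt (pos k) (word k) t) T →
      (∀ {u} → Keep u → Factor u t) →
      ∃[ t′ ] (Inserted T t t′ × RightFactorsSurvive T t t′)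
    insert-sorted [] {t} [] [] [] keeps =
      t , record { length-t′ = sym (+-identityʳ _) ; keeps = keeps ; blocks = [] } , λ a _ occ → a , occ
    insert-sorted (k ∷ T) (rightmost ∷ sorted) (adm ∷ adms) ((y , refl) ∷ occs) keeps =
      extend (insert-sorted T sorted adms occs₁ keeps₁)
      where
      open Admissible adm
      t₀ = pos k ++ word k ++ y
      t₁ = pos k ++ block k ++ word k ++ y

      occs₁ : All (λ j → OccursAt (pos j) (word j) t₁) T
      occs₁ = All.tabulate λ {j} j∈ →
        early-survives (proj₂ conjugate) (pos k) y (pos j) (All.lookup occs j∈) (All.lookup rightmost j∈)
          (maximal (Admissible.kept (All.lookup adms j∈)))

      keeps₁ : ∀ {u} → Keep u → Factor u t₁
      keeps₁ u∈ = factor-survives (proj₂ conjugate) (pos k) y (maximal u∈) (keeps u∈)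

      extend : ∃[ t′ ] (Inserted T t₁ t′ × RightFactorsSurvive T t₁ t′) →
               ∃[ t′ ] (Inserted (k ∷ T) t₀ t′ × RightFactorsSurvive (k ∷ T) t₀ t′)
      extend (t′ , ins , right) =
        t′ , record { length-t′ = length-t′-total ; keeps = keeps′ ; blocks = block-k ∷ blocks } , right′
        where
        open Inserted ins renaming (keeps to keeps′)
        rest = sum (map (length ∘ block) T)

        length-t′-total : length t′ ≡ length t₀ + (length (block k) + rest)
        length-t′-total = begin
          length t′                              ≡⟨ length-t′ ⟩
          length t₁ + rest                       ≡⟨ cong (_+ rest) (length-insert (pos k) (block k) (word k ++ y)) ⟩
          length t₀ + length (block k) + rest    ≡⟨ +-assoc (length t₀) (length (block k)) rest ⟩
          length t₀ + (length (block k) + rest)  ∎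
          where open ≡-Reasoning

        block-k : Factor (block k ++ word k) t′
        block-k = right (pos k) rightmost (y , cong (pos k ++_) (++-assoc (block k) (word k) y))

        right′ : RightFactorsSurvive (k ∷ T) t₀ t′
        right′ a (k≤a ∷ T≤a) occ with late-survives {x = pos k} {word k} {y} a (block k) occ k≤a
        ... | a′ , a≤a′ , occ′ = right a′ (All.map (λ j≤a → ≤-trans j≤a a≤a′) T≤a) occ′

    open Sort (On.decTotalOrder (Flip.decTotalOrder ≤-decTotalOrder) (length ∘ pos))
      using (sort; sort-↗; sort-↭)

    insert-blocks : ∀ T {t} → All Admissible T → All (λ k → OccursAt (pos k) (word k) t) T →
      (∀ {u} → Keep u → Factor u t) → ∃[ t′ ] Inserted T t t′
    insert-blocks T {t} adms occs keeps
      with insert-sorted (sort T) (Linked⇒AllPairs (λ p q → ≤-trans q p) (sort-↗ T))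
             (All-resp-↭ (↭-sym (sort-↭ T)) adms) (All-resp-↭ (↭-sym (sort-↭ T)) occs) keeps
    ... | t′ , ins , _ = t′ , record
      { length-t′ = trans length-t′ (cong (length t +_) (sum-↭ (Perm.map⁺ (length ∘ block) (sort-↭ T))))
      ; keeps     = Inserted.keeps ins
      ; blocks    = All-resp-↭ (sort-↭ T) blocks
      }
      where open Inserted ins using (length-t′; blocks)

foldl-select : ∀ {E B : Set} (p : E → Bool) (f : E → B) (d : B) es →
  (All (λ e → ¬ T (p e)) es × foldl (λ r e → if p e then f e else r) d es ≡ d) ⊎
  (∃[ e ] (e ∈ es × T (p e) × foldl (λ r e → if p e then f e else r) d es ≡ f e))
foldl-select p f d [] = inj₁ ([] , refl)
foldl-select p f d (e ∷ es) with foldl-select p f (if p e then f e else d) es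
... | inj₂ (e′ , e′∈ , pe′ , r≡) = inj₂ (e′ , there e′∈ , pe′ , r≡)
... | inj₁ (none , r≡) with p e in pe
...   | true  = inj₂ (e , here refl , subst T (sym pe) _ , r≡)
...   | false = inj₁ (subst T pe ∷ none , r≡)

module _ {A : Set} (_≟_ : DecidableEquality A) where

  searchOv-sound : ∀ s t n → let k = searchOv _≟_ s t n in drop (length s ∸ k) s ≡ take k t
  searchOv-sound s t zero = drop-all (length s) s ≤-refl
  searchOv-sound s t (suc k) with LP.≡-dec _≟_ (drop (length s ∸ suc k) s) (take (suc k) t)
  ... | yes suffix≡prefix = suffix≡prefix
  ... | no _              = searchOv-sound s t k

  ovLen-sound : ∀ s t → drop (length s ∸ ovLen _≟_ s t) s ≡ take (ovLen _≟_ s t) t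
  ovLen-sound s t = searchOv-sound s t (if _==_ _≟_ s t then length s ∸ 1 else length s)

  pref-extends : ∀ s t → ∃[ z ] (pref _≟_ s t ++ t ≡ s ++ z)
  pref-extends s t = drop k t , (begin
    take j s ++ t                         ≡⟨ cong (take j s ++_) (take++drop≡id k t) ⟨
    take j s ++ take k t ++ drop k t      ≡⟨ cong (λ z → take j s ++ z ++ drop k t) (ovLen-sound s t) ⟨
    take j s ++ drop j s ++ drop k t      ≡⟨ ++-assoc (take j s) (drop j s) (drop k t) ⟨
    (take j s ++ drop j s) ++ drop k t    ≡⟨ cong (_++ drop k t) (take++drop≡id j s) ⟩
    s ++ drop k t                         ∎)
    where
    open ≡-Reasoning
    k = ovLen _≟_ s t
    j = length s ∸ k

  module _ {m : ℕ} (S : Fin m → List A) (order : List (Fin m × Fin m)) where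
    open MGreedy _≟_ S
    open Cover order

    SuccChain : List (Fin m) → Set
    SuccChain = Linked (λ i j → succ i ≡ j)

    prefToSucc : Fin m → List A
    prefToSucc i = pref _≟_ (S i) (S (succ i))

    chain-extends : ∀ v vs → SuccChain (v ∷ vs) →
                    ∃[ z ] (concat (map prefToSucc (v ∷ vs)) ++ S (succ (lastOf v vs)) ≡ S v ++ z)
    chain-extends v [] [-] =
      map₂ (trans (cong (_++ S (succ v)) (++-identityʳ _))) (pref-extends (S v) (S (succ v)))
    chain-extends v (_ ∷ vs) (refl ∷ chain)
      with chain-extends (succ v) vs chain | pref-extends (S v) (S (succ v))
    ... | z₁ , e₁ | z₀ , e₀ = z₀ ++ z₁ , (begin
      (prefToSucc v ++ C) ++ W          ≡⟨ ++-assoc (prefToSucc v) C W ⟩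
      prefToSucc v ++ C ++ W            ≡⟨ cong (prefToSucc v ++_) e₁ ⟩
      prefToSucc v ++ S (succ v) ++ z₁  ≡⟨ ++-assoc (prefToSucc v) (S (succ v)) z₁ ⟨
      (prefToSucc v ++ S (succ v)) ++ z₁ ≡⟨ cong (_++ z₁) e₀ ⟩
      (S v ++ z₀) ++ z₁                 ≡⟨ ++-assoc (S v) z₀ z₁ ⟩
      S v ++ z₀ ++ z₁                   ∎)
      where
      open ≡-Reasoning
      C = concat (map prefToSucc (succ v ∷ vs))
      W = S (succ (lastOf (succ v) vs))

    orbitFrom-succChain : ∀ n start v → SuccChain (v ∷ orbitFrom n start (succ v))
    orbitFrom-succChain zero    start v = [-]
    orbitFrom-succChain (suc n) start v with succ (succ v) =ᶠ start
    ... | true  = refl ∷ [-]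
    ... | false = refl ∷ orbitFrom-succChain n start (succ v)

    orbitFrom-∷ : ∀ n start v → .{{NonZero n}} →
                  ∃[ rest ] (orbitFrom n start v ≡ v ∷ rest × SuccChain (v ∷ rest))
    orbitFrom-∷ (suc n) start v with succ v =ᶠ start
    ... | true  = [] , refl , [-]
    ... | false = _ , refl , orbitFrom-succChain n start v

    orbit-∷ : ∀ c → ∃[ rest ] (orbit c ≡ c ∷ rest × SuccChain (c ∷ rest))
    orbit-∷ c = orbitFrom-∷ m c c {{nonZeroIndex c}}

    lastOf-orbitFrom : ∀ n start v d a → a ∈ orbitFrom n start v → succ a ≡ start →
                       succ (lastOf d (orbitFrom n start v)) ≡ start
    lastOf-orbitFrom (suc n) start v d a a∈ closes with succ v Fin.≟ start
    ... | yes returns = returns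
    ... | no ¬returns with a∈
    ...   | here refl  = contradiction closes ¬returns
    ...   | there a∈′  = lastOf-orbitFrom n start (succ v) v a a∈′ closes

    inList⇒∈ : ∀ {i} vs → T (inList i vs) → i ∈ vs
    inList⇒∈ vs p = Any.map toWitness (any⁻ _ vs p)

    ∈⇒inList : ∀ {i vs} → i ∈ vs → T (inList i vs)
    ∈⇒inList i∈ = any⁺ _ (Any.map (λ { refl → fromWitness refl }) i∈)

    TailsUnique : List Edge → Set
    TailsUnique = AllPairs (λ e f → proj₁ e ≢ proj₁ f)

    greedyStep-tailsUnique : ∀ acc e → TailsUnique acc → TailsUnique (greedyStep acc e)
    greedyStep-tailsUnique acc (i , j) unique
      with any (λ e → (proj₁ e =ᶠ i) ∨ (proj₂ e =ᶠ j)) acc in clash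
    ... | true  = unique
    ... | false = AllPairs.++⁺ unique ([] ∷ []) (All.tabulate λ e∈ → no-clash e∈ ∷ [])
      where
      tail-clashes : ∀ {e} → proj₁ e ≡ i → T ((proj₁ e =ᶠ i) ∨ (proj₂ e =ᶠ j))
      tail-clashes {e} tail≡i = Equivalence.from (T-∨ {proj₁ e =ᶠ i}) (inj₁ (fromWitness tail≡i))

      no-clash : ∀ {e} → e ∈ acc → proj₁ e ≢ i
      no-clash e∈ tail≡i = subst T clash (any⁺ _ (Any.map (λ { refl → tail-clashes tail≡i }) e∈))

    edges-tailsUnique : TailsUnique edges
    edges-tailsUnique = go order [] []
      where
      go : ∀ es acc → TailsUnique acc → TailsUnique (foldl greedyStep acc es)
      go []       acc unique = unique
      go (e ∷ es) acc unique = go es (greedyStep acc e) (greedyStep-tailsUnique acc e unique)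

    succ-edge : ∀ {i j} → (i , j) ∈ edges → succ i ≡ j
    succ-edge = go edges edges-tailsUnique
      where
      go : ∀ {i j} es → TailsUnique es → (i , j) ∈ es →
           foldr (λ e r → if proj₁ e =ᶠ i then proj₂ e else r) i es ≡ j
      go {i} (_ ∷ _) (_ ∷ _) (here refl) with i Fin.≟ i
      ... | yes _   = refl
      ... | no i≢i = contradiction refl i≢i
      go {i} (e ∷ es) (distinct ∷ unique) (there e∈) with proj₁ e Fin.≟ i
      ... | yes refl = contradiction refl (All.lookup distinct e∈)
      ... | no _     = go es unique e∈

    succ-fixed : ∀ {i} → All (λ e → proj₁ e ≢ i) edges → succ i ≡ i
    succ-fixed = go edges
      where
      go : ∀ {i d} es → All (λ e → proj₁ e ≢ i) es →
           foldr (λ e r → if proj₁ e =ᶠ i then proj₂ e else r) d es ≡ d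
      go []       []                 = refl
      go {i} (e ∷ es) (e≢i ∷ others) with proj₁ e Fin.≟ i
      ... | yes e≡i = contradiction e≡i e≢i
      ... | no _    = go es others

    ∈-orbit : ∀ c → c ∈ orbit c
    ∈-orbit c with orbit-∷ c
    ... | _ , eq , _ = subst (c ∈_) (sym eq) (here refl)

    closingHead-returns : ∀ c → closingHead c ≡ c → ∃[ a ] (a ∈ orbit c × succ a ≡ c)
    closingHead-returns c closed with foldl-select (λ e → inList (proj₁ e) (orbit c)) proj₂ c edges
    ... | inj₂ (e , e∈ , tail∈ , head≡) =
      proj₁ e , inList⇒∈ (orbit c) tail∈ , trans (succ-edge e∈) (trans (sym head≡) closed)
    ... | inj₁ (none , _) = c , ∈-orbit c , succ-fixed (All.map (λ {e} → leaves-elsewhere {e}) none)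
      where
      leaves-elsewhere : ∀ {e : Edge} → ¬ T (inList (proj₁ e) (orbit c)) → proj₁ e ≢ c
      leaves-elsewhere tail∉ refl = tail∉ (∈⇒inList (∈-orbit c))

    cycle-closes : ∀ c → closingHead c ≡ c → succ (lastOf c (orbit c)) ≡ c
    cycle-closes c closed with closingHead-returns c closed
    ... | a , a∈ , returns = lastOf-orbitFrom m c c c a a∈ returns

    cyclePrefix : Fin m → List A
    cyclePrefix c = concat (map prefToSucc (orbit c))

    cyclePrefix-conjugate : ∀ c → closingHead c ≡ c → ∃[ Q ] (cyclePrefix c ++ S c ≡ S c ++ Q)
    cyclePrefix-conjugate c closed with orbit-∷ c | cycle-closes c closed
    ... | rest , orbit≡ , chain | closes rewrite orbit≡ =
      subst (λ d → ∃[ Q ] (concat (map prefToSucc (c ∷ rest)) ++ S d ≡ S c ++ Q)) closes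
            (chain-extends c rest chain)

    length-cyclePrefix : ∀ c → length (cyclePrefix c) ≡ w c
    length-cyclePrefix c = go (orbit c)
      where
      go : ∀ l → length (concat (map prefToSucc l)) ≡ sum (map (λ i → dist _≟_ (S i) (S (succ i))) l)
      go []      = refl
      go (i ∷ l) = trans (length-++ (prefToSucc i)) (cong (length (prefToSucc i) +_) (go l))

    module _ (factor-free : ∀ i j → i ≢ j → ¬ Substring _≟_ (S i) (S j))
             (t : List A) (t-super : IsSuperstring _≟_ (map S (allFin m)) t) where

      private
        Keep : List A → Set
        Keep = _∈ map S (allFin m)

        open Insertions Keep

        occurrence : ∀ c → Factor (S c) t
        occurrence c = t-super (S c) (∈-map⁺ S (∈-allFin c))

        insertionAt : Fin m → Insertion
        insertionAt c = record { pos = proj₁ (occurrence c) ; word = S c ; block = cyclePrefix c }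

        closed : ∀ {c} → c ∈ smallCycles → closingHead c ≡ c
        closed c∈ = proj₂ (∈-filter⁻ (λ v → closingHead v Fin.≟ v) {xs = allFin m}
                            (proj₁ (∈-filter⁻ (T? ∘ isSmall) {xs = cycleStarts} c∈)))

        maximal : ∀ c {u} → Keep u → Factor (S c) u → u ≡ S c
        maximal c u∈ S-c⊑u with ∈-map⁻ S u∈
        ... | i , _ , refl with c Fin.≟ i
        ...   | yes refl = refl
        ...   | no c≢i   = contradiction S-c⊑u (factor-free c i c≢i)

        admissible : All Admissible (map insertionAt smallCycles)
        admissible = All.map⁺ $ All.tabulate λ {c} c∈ → record
          { conjugate = cyclePrefix-conjugate c (closed c∈)
          ; kept      = ∈-map⁺ S (∈-allFin c)
          ; maximal   = maximal c
          }

      small-cycles-superstring : ∃[ t′ ] (length t′ ≡ length t + smallWeight × IsSuperstring _≟_ S′ t′)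
      small-cycles-superstring
        with insert-blocks (map insertionAt smallCycles) admissible
               (All.map⁺ (All.tabulate λ {c} _ → proj₂ (occurrence c))) (t-super _)
      ... | t′ , ins = t′ , length-t′≡ , t′-super
        where
        open Inserted ins

        length-t′≡ : length t′ ≡ length t + smallWeight
        length-t′≡ = trans length-t′ (cong (length t +_) (cong sum
          (trans (sym (map-∘ smallCycles)) (map-cong length-cyclePrefix smallCycles))))

        t′-super : IsSuperstring _≟_ S′ t′
        t′-super u u∈ with ∈-++⁻ (map S (filter (λ i → T? (not (inSmallCycle i))) (allFin m))) u∈
        ... | inj₁ u∈S with ∈-map⁻ S u∈S
        ...   | i , _ , refl = keeps (∈-map⁺ S (∈-allFin i))
        t′-super u u∈ | inj₂ u∈R′ with ∈-map⁻ R′ u∈R′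
        ...   | c , c∈ , refl = All.lookup (All.map⁻ blocks) c∈


lemma13 : {A : Set} (_≟_ : DecidableEquality A) {m : ℕ} (S : Fin m → List A) →
    2 ≤ m →
    Injective _≡_ _≡_ S →
    (∀ i j → i ≢ j → ¬ Substring _≟_ (S i) (S j)) →
    (order : List (Fin m × Fin m)) →
    order ↭ MGreedy.allPairs _≟_ S →
    Linked (λ p q → MGreedy.ovE _≟_ S q ≤ MGreedy.ovE _≟_ S p) order →
    (t t′ : List A) →
    IsShortestSuperstring _≟_ (map S (allFin m)) t →
    IsShortestSuperstring _≟_ (MGreedy.Cover.S′ _≟_ S order) t′ →
    length t′ ≤ length t + MGreedy.Cover.smallWeight _≟_ S order
lemma13 _≟_ S _ _ factor-free order _ _ t t′ (t-super , _) (_ , t′-shortest)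
  with small-cycles-superstring _≟_ S order factor-free t t-super
... | t″ , t″-length , t″-super = ≤-trans (t′-shortest t″ t″-super) (≤-reflexive t″-length)
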